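{- Let $a,b\ge1$ be integers and $g=4b^2$. Let $\mathcal{C}$ be a chain with spine $P=v_0,\dots,v_m$ and arc partition $A(P)=A_1\cup A_2$, and suppose $|A_2|\ge a(b+1)-1$. Then $\mathcal{C}$ contains a strong $(a,b)$-alternating-path $R$ with $s_1(R)=v_0$ and $t_a(R)=v_m$.
   Context: Digraphs are finite, loopless, without parallel arcs. Fix $b\ge1$, $g:=4b^2$. Gadgets (each with designated vertices $p,q$ and arc $(p,q)$): Type I: a directed cycle of length at least $g$ through $(p,q)$. Basic type II: vertices $p,q,r$, a directed path $P_1$ from $r$ to $p$ of length at least $2b^2+b-2$ with $q\notin V(P_1)$, and an arc from every vertex of $P_1$ to $q$. Type III: vertices $p,q,r$, the arc $(p,q)$, and two internally vertex-disjoint directed paths $P_1,P_2$ from $p$ and from $q$ respectively to $r$, each of length at least $2b-1$. A trivial gadget consists only of $p,q$ and the arc $(p,q)$. A chain $\mathcal{C}$ consists of a directed path $P=v_0,\dots,v_m$ (the spine), a partition $A_1\cup A_2$ of its arc set, and non-trivial gadgets $(G_e:e\in A_2)$ such that: each $G_e$ is of type I, type III or basic type II; for $e=(v_i,v_{i+1})\in A_2$, $p(G_e)=v_i$ and $q(G_e)=v_{i+1}$ and $V(G_e)\cap V(P)=\{v_i,v_{i+1}\}$; and $V(G_e)\cap V(G_f)\subseteq V(P)$ for distinct $e,f\in A_2$. The chain is identified with the digraph $P\cup\bigcup_{e\in A_2}G_e$. An $(a,b)$-alternating-path is an oriented path $R$ consisting of vertices $s_1,\dots,s_a,t_1,\dots,t_a$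 and pairwise internally vertex-disjoint directed paths $Q_1,\dots,Q_a,Q'_1,\dots,Q'_{a-1}$, $Q_i$ from $s_i$ to $t_i$, $Q'_i$ from $s_{i+1}$ to $t_i$, with $Q_2,\dots,Q_{a-1},Q'_1,\dots,Q'_{a-1}$ of length at least $b$; it is strong if moreover $Q_1$ and $Q_a$ have length at least $b$. -}

module Defs where

open import Data.Nat using (ℕ; zero; suc; _+_; _*_; _∸_; _≤_; _<_)
open import Data.Fin using (Fin; toℕ; inject₁) renaming (zero to fzero; suc to fsuc)
open import Data.List using (List; []; _∷_; _++_; head; last; length; reverse; drop)
open import Data.List.Membership.Propositional using (_∈_)
open import Data.List.Relation.Unary.Unique.Propositional using (Unique)
open import Data.Vec using (Vec; lookup) renaming ([] to []ᵛ; _∷_ to _∷ᵛ_)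
open import Data.Maybe using (Maybe; just; nothing)
open import Data.Product using (Σ; ∃; _×_; _,_)
open import Data.Sum using (_⊎_)
open import Data.Empty using (⊥)
open import Relation.Binary.PropositionalEquality using (_≡_; _≢_)
open import Function.Definitions using (Injective)

ArcRel : Set₁
ArcRel = ℕ → ℕ → Set

ArcOf : List ℕ → ℕ → ℕ → Set
ArcOf (u ∷ v ∷ xs) x y = (x ≡ u × y ≡ v) ⊎ ArcOf (v ∷ xs) x y
ArcOf _ x y = ⊥

len : List ℕ → ℕ
len xs = length xs ∸ 1

DirPath : ArcRel → ℕ → ℕ → List ℕ → Set
DirPath D u w xs =
  head xs ≡ just u × last xs ≡ just w × Unique xs
  × (∀ x y → ArcOf xs x y → D x y)

-- "abstract" paths (only using their own arcs)
IsPath : ℕ → ℕ → List ℕ → Set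
IsPath u w xs = head xs ≡ just u × last xs ≡ just w × Unique xs

g : ℕ → ℕ
g b = 4 * b * b

-- Non-trivial gadgets, described by their defining data; p and q are the
-- designated vertices (given externally: they are the ends of the spine arc).
data Gadget : Set where
  -- type I: the directed cycle formed by the path c (from q to p) and the arc (p,q)
  typeI   : (c : List ℕ) → Gadget
  -- basic type II: the path P1 (from r to p) and arcs from every vertex of P1 to q
  typeII  : (r : ℕ) (P1 : List ℕ) → Gadget
  -- type III: arc (p,q), path P1 from p to r and path P2 from q to r
  typeIII : (r : ℕ) (P1 P2 : List ℕ) → Gadget

GVert : ℕ → ℕ → Gadget → ℕ → Set
GVert p q (typeI c) x = x ≡ p ⊎ x ≡ q ⊎ x ∈ c
GVert p q (typeII r P1) x = x ≡ p ⊎ x ≡ q ⊎ x ≡ r ⊎ x ∈ P1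
GVert p q (typeIII r P1 P2) x = x ≡ p ⊎ x ≡ q ⊎ x ≡ r ⊎ x ∈ P1 ⊎ x ∈ P2

GArc : ℕ → ℕ → Gadget → ArcRel
GArc p q (typeI c) x y = (x ≡ p × y ≡ q) ⊎ ArcOf c x y
GArc p q (typeII r P1) x y = ArcOf P1 x y ⊎ (x ∈ P1 × y ≡ q)
GArc p q (typeIII r P1 P2) x y = (x ≡ p × y ≡ q) ⊎ ArcOf P1 x y ⊎ ArcOf P2 x y

ValidGadget : ℕ → ℕ → ℕ → Gadget → Set
ValidGadget b p q (typeI c) =
  p ≢ q × IsPath q p c × g b ≤ len c + 1
ValidGadget b p q (typeII r P1) =
  IsPath r p P1 × (q ∈ P1 → ⊥) × 2 * b * b + b ∸ 2 ≤ len P1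
ValidGadget b p q (typeIII r P1 P2) =
  p ≢ q × IsPath p r P1 × IsPath q r P2
  × (∀ x → x ∈ P1 → x ∈ P2 → x ≡ r)
  × 2 * b ∸ 1 ≤ len P1 × 2 * b ∸ 1 ≤ len P2

-- A chain: spine v 0, ..., v m; the i-th spine arc (v i, v (i+1)) is in A₂
-- iff lab i ≡ just G, in which case G is its gadget; otherwise it is in A₁.
record Chain : Set where
  field
    m   : ℕ
    v   : Fin (suc m) → ℕ
    lab : Fin m → Maybe Gadget

open Chain public

vl vr : (C : Chain) → Fin (m C) → ℕ
vl C i = v C (inject₁ i)
vr C i = v C (fsuc i)

OnSpine : Chain → ℕ → Set
OnSpine C x = ∃ λ j → v C j ≡ x

ValidChain : ℕ → Chain → Set
ValidChain b C =
  Injective _≡_ _≡_ (v C)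
  × (∀ i G → lab C i ≡ just G → ValidGadget b (vl C i) (vr C i) G)
  × (∀ i G → lab C i ≡ just G → ∀ x →
       (GVert (vl C i) (vr C i) G x × OnSpine C x) ⇔′ (x ≡ vl C i ⊎ x ≡ vr C i))
  × (∀ i j G H → i ≢ j → lab C i ≡ just G → lab C j ≡ just H → ∀ x →
       GVert (vl C i) (vr C i) G x → GVert (vl C j) (vr C j) H x → OnSpine C x)
  where
  _⇔′_ : Set → Set → Set
  A ⇔′ B = (A → B) × (B → A)

countJust : ∀ {A : Set} {k} → (Fin k → Maybe A) → ℕ
countJust {k = zero} f = 0
countJust {k = suc k} f with f fzero
... | just _  = suc (countJust (λ i → f (fsuc i)))
... | nothing = countJust (λ i → f (fsuc i))

A₂size : Chain → ℕ
A₂size C = countJust (lab C)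

ChainArc : Chain → ArcRel
ChainArc C x y =
  (∃ λ i → x ≡ vl C i × y ≡ vr C i)
  ⊎ (∃ λ i → Σ Gadget λ G → lab C i ≡ just G × GArc (vl C i) (vr C i) G x y)

-- vertex sequence of the oriented path
--  Q₁ , reverse Q'₁ , Q₂ , reverse Q'₂ , ... , Q_a  (shared ends counted once)
walk : ∀ {n} → Vec (List ℕ) (suc n) → Vec (List ℕ) n → List ℕ
walk (q ∷ᵛ []ᵛ) []ᵛ = q
walk (q ∷ᵛ (q₂ ∷ᵛ qs)) (q' ∷ᵛ qs') =
  q ++ drop 1 (reverse q') ++ drop 1 (walk (q₂ ∷ᵛ qs) qs')

-- an (a,b)-alternating-path in the digraph D, a = suc n;
-- Q i = Q_{i+1} (from s_{i+1} to t_{i+1}), Q' i = Q'_{i+1} (from s_{i+2} to t_{i+1})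
record AltPath (D : ArcRel) (a b : ℕ) : Set where
  field
    n   : ℕ
    a≡  : a ≡ suc n
    s t : Fin (suc n) → ℕ
    Q   : Vec (List ℕ) (suc n)
    Q'  : Vec (List ℕ) n
    Q-path  : ∀ i → DirPath D (s i) (t i) (lookup Q i)
    Q'-path : ∀ i → DirPath D (s (fsuc i)) (t (inject₁ i)) (lookup Q' i)
    -- R is an oriented path: all its vertices are distinct (this also gives
    -- that the Q's and Q''s are pairwise internally vertex-disjoint)
    oriented : Unique (walk Q Q')
    Q'-long  : ∀ i → b ≤ len (lookup Q' i)
    Q-mid-long : ∀ i → 0 < toℕ i → toℕ i < n → b ≤ len (lookup Q i)

open AltPath public

-- strong: additionally Q_1 and Q_a have length ≥ b (so every Q_i does)
Strong : ∀ {D a b} → AltPath D a b → Set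
Strong {b = b} R = ∀ i → b ≤ len (lookup (Q R) i)

first-s : ∀ {D a b} → AltPath D a b → ℕ
first-s R = s R fzero

last-t : ∀ {D a b} → (R : AltPath D a b) → ℕ
last-t R = t R (Data.Fin.fromℕ (n R))

-- The path is built from the back, by induction on a.  A "tail path" from v_k
-- is a strong alternating path from v_k to v_M all of whose vertices lie in
-- the part of the chain from v_k onwards.  If the gadgets at indices ≥ k number
-- at least a(b+1) − 1, then there is a tail path with a forward paths Q from v_k:
--   * a = 1: the spine segment v_k … v_M is long enough;
--   * a > 1: pick the first gadget at an index j ≥ k + b; as the b arcs after
--     v_k carry at most b gadgets, at least (a−1)(b+1) − 1 gadgets lie beyond
--     j.  Take a tail path from v_{j+1} by induction and prepend the spine
--     segment v_k … v_j (of length ≥ b) together with a backward path Q'₁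
--     through the gadget at j (its cycle, the end of its path P₁, or its path
--     P₂, according to the type).
-- Disjointness of the new pieces from the old tail path comes from the
-- separation property of chains: the part up to gadget j meets the part from
-- v_{j+1} onwards only in v_{j+1}.
module Submission where

open import Data.Nat using (ℕ; zero; suc; _+_; _*_; _∸_; _≤_; _<_; z≤n; s≤s; _<?_)
open import Data.Nat.Properties
open import Data.List using (List; []; _∷_; _++_; head; last; length; reverse; drop; [_])
open import Data.List.Properties using (++-assoc; reverse-++; length-++; ++-identityʳ)
open import Data.List.Membership.Propositional using (_∈_; _∉_)
open import Data.List.Membership.Propositional.Properties using (∈-++⁺ˡ; ∈-++⁺ʳ; ∈-++⁻)
open import Data.List.Relation.Unary.Any using (here; there)
open import Data.List.Relation.Unary.Any.Properties using () renaming (reverse⁻ to ∈-reverse⁻)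
import Data.List.Relation.Unary.All as All
open import Data.List.Relation.Unary.Unique.Propositional using (Unique; []; _∷_)
open import Data.List.Relation.Unary.Unique.Propositional.Properties using (++⁺; drop⁺; Unique[x∷xs]⇒x∉xs)
open import Data.List.Relation.Binary.Permutation.Propositional using (↭⇒↭ₛ; ↭-sym)
open import Data.List.Relation.Binary.Permutation.Propositional.Properties using (↭-reverse)
open import Data.List.Relation.Binary.Permutation.Setoid.Properties using (Unique-resp-↭)
open import Data.Maybe using (Maybe; just; nothing)
open import Data.Product using (Σ; ∃; _×_; _,_; proj₁; proj₂)
open import Data.Sum using (_⊎_; inj₁; inj₂; [_,_]′)
open import Data.Empty using (⊥; ⊥-elim)
open import Data.Fin using (Fin; toℕ; fromℕ; fromℕ<; inject₁) renaming (zero to fzero; suc to fsuc)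
open import Data.Fin.Properties
  using (toℕ-fromℕ<; toℕ-inject₁; toℕ<n; toℕ-fromℕ; fromℕ<-toℕ; fromℕ<-injective)
open import Data.Vec using (Vec; lookup) renaming ([] to []ᵛ; _∷_ to _∷ᵛ_)
open import Relation.Binary.PropositionalEquality
  using (_≡_; refl; sym; trans; cong; subst; subst₂; _≢_; setoid)
open import Relation.Nullary using (yes; no)
open import Function using (_∘_)
open import Defs

private variable
  A : Set
  xs ys : List A

head-split : ∀ {h : A} xs → head xs ≡ just h → ∃ λ r → xs ≡ h ∷ r
head-split (x ∷ xs) refl = xs , refl

last-split : ∀ {t : A} xs → last xs ≡ just t → ∃ λ r → xs ≡ r ++ [ t ]
last-split (x ∷ []) refl = [] , refl
last-split (x ∷ y ∷ xs) e with last-split (y ∷ xs) e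
... | r , eq = x ∷ r , cong (x ∷_) eq

head-++ : ∀ {h : A} xs ys → head xs ≡ just h → head (xs ++ ys) ≡ just h
head-++ (x ∷ xs) ys e = e

last-++ : ∀ {p : A} xs ys → last xs ≡ just p → last (xs ++ ys) ≡ last (p ∷ ys)
last-++ (x ∷ []) [] refl = refl
last-++ (x ∷ []) (y ∷ ys) refl = refl
last-++ (x ∷ y ∷ xs) ys e = last-++ (y ∷ xs) ys e

last-++-∷ : ∀ (xs : List A) y ys → last (xs ++ y ∷ ys) ≡ last (y ∷ ys)
last-++-∷ [] y ys = refl
last-++-∷ (x ∷ []) y ys = refl
last-++-∷ (x ∷ x' ∷ xs) y ys = last-++-∷ (x' ∷ xs) y ys

∈-++-elim : {P : A → Set} → (∀ {y} → y ∈ xs → P y) → (∀ {y} → y ∈ ys → P y)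
          → ∀ {y} → y ∈ xs ++ ys → P y
∈-++-elim {xs = xs} f g i = [ f , g ]′ (∈-++⁻ xs i)

∈-drop1 : ∀ {y : A} xs → y ∈ drop 1 xs → y ∈ xs
∈-drop1 (x ∷ xs) i = there i

split-suffix : ∀ (xs : List A) c → c < length xs
             → Σ (List A) λ ys → Σ A λ x → Σ (List A) λ zs → xs ≡ ys ++ x ∷ zs × length zs ≡ c
split-suffix (a ∷ xs) c lt with c <? length xs
... | yes c<xs with split-suffix xs c c<xs
...   | ys , x , zs , eq , lz = a ∷ ys , x , zs , cong (a ∷_) eq , lz
split-suffix (a ∷ xs) c lt | no c≮xs = [] , a , xs , refl , ≤-antisym (≮⇒≥ c≮xs) (≤-pred lt)

len-++ˡ : ∀ (xs ys : List ℕ) → len xs ≤ len (xs ++ ys)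
len-++ˡ xs ys rewrite length-++ xs {ys} = ∸-monoˡ-≤ 1 (m≤m+n (length xs) (length ys))

len-++ʳ : ∀ (xs ys : List ℕ) → len ys ≤ len (xs ++ ys)
len-++ʳ xs ys rewrite length-++ xs {ys} = ∸-monoˡ-≤ 1 (m≤n+m (length ys) (length xs))

unique-tail : ∀ {x : A} → Unique (x ∷ xs) → Unique xs
unique-tail (_ ∷ u) = u

unique-++ˡ : ∀ (xs : List A) → Unique (xs ++ ys) → Unique xs
unique-++ˡ [] u = []
unique-++ˡ (x ∷ xs) (x∉ ∷ u) = All.tabulate (λ i → All.lookup x∉ (∈-++⁺ˡ i)) ∷ unique-++ˡ xs u

unique-++ʳ : ∀ (xs : List A) → Unique (xs ++ ys) → Unique ys
unique-++ʳ [] u = u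
unique-++ʳ (x ∷ xs) u = unique-++ʳ xs (unique-tail u)

unique-++-disjoint : ∀ (xs : List A) {y} → Unique (xs ++ ys) → y ∈ xs → y ∈ ys → ⊥
unique-++-disjoint (x ∷ xs) u (here refl) j = Unique[x∷xs]⇒x∉xs u (∈-++⁺ʳ xs j)
unique-++-disjoint (x ∷ xs) u (there i) j = unique-++-disjoint xs (unique-tail u) i j

unique-reverse : ∀ {A : Set} {xs : List A} → Unique xs → Unique (reverse xs)
unique-reverse {A} {xs} = Unique-resp-↭ (setoid A) (↭⇒↭ₛ (↭-sym (↭-reverse xs)))

reverse-init : ∀ (xs : List A) {t} → Unique xs → last xs ≡ just t
             → Unique (drop 1 (reverse xs)) × (∀ {y} → y ∈ drop 1 (reverse xs) → y ∈ xs × y ≢ t)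
reverse-init xs {t} u e with last-split xs e
... | r , refl rewrite reverse-++ r [ t ] =
  unique-reverse {xs = r} (unique-++ˡ r u) ,
  λ i → ∈-++⁺ˡ (∈-reverse⁻ {xs = r} i) ,
        λ { refl → unique-++-disjoint r u (∈-reverse⁻ {xs = r} i) (here refl) }

head∉drop1 : ∀ {h : A} xs → Unique xs → head xs ≡ just h → h ∉ drop 1 xs
head∉drop1 (x ∷ xs) u refl = Unique[x∷xs]⇒x∉xs u

≤len⇒<length : ∀ {b} (xs : List ℕ) → 1 ≤ b → b ≤ len xs → b < length xs
≤len⇒<length [] 1≤b b≤0 = ⊥-elim (<⇒≱ 1≤b b≤0)
≤len⇒<length (x ∷ xs) _ b≤ = s≤s b≤

arc-∷ : ∀ (a : ℕ) ys {x z} → ArcOf ys x z → ArcOf (a ∷ ys) x z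
arc-∷ a (y ∷ ys) ar = inj₂ ar

arc-suffix : ∀ (xs ys : List ℕ) {x z} → ArcOf ys x z → ArcOf (xs ++ ys) x z
arc-suffix [] ys ar = ar
arc-suffix (a ∷ xs) ys ar = arc-∷ a (xs ++ ys) (arc-suffix xs ys ar)

arc-++ : ∀ (xs : List ℕ) {p} ys {x z} → last xs ≡ just p → ArcOf (xs ++ ys) x z
       → ArcOf xs x z ⊎ ArcOf (p ∷ ys) x z
arc-++ (a ∷ []) ys refl ar = inj₂ ar
arc-++ (a ∷ b ∷ xs) ys e (inj₁ eq) = inj₁ (inj₁ eq)
arc-++ (a ∷ b ∷ xs) ys e (inj₂ ar) with arc-++ (b ∷ xs) ys e ar
... | inj₁ ar' = inj₁ (inj₂ ar')
... | inj₂ ar' = inj₂ ar'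

path-++ : ∀ {D : ArcRel} {u p w} xs ys → DirPath D u p xs → DirPath D p w (p ∷ ys)
        → (∀ {y} → y ∈ xs → y ∈ ys → ⊥) → DirPath D u w (xs ++ ys)
path-++ xs ys (hx , lx , ux , ax) (_ , ly , uy , ay) disj =
  head-++ xs ys hx , trans (last-++ xs ys lx) ly ,
  ++⁺ ux (unique-tail uy) (λ (i , i') → disj i i') ,
  λ x z ar → [ ax x z , ay x z ]′ (arc-++ xs ys lx ar)

path-∷ : ∀ {D : ArcRel} {x h t} L → DirPath D h t L → x ∉ L → D x h → DirPath D x t (x ∷ L)
path-∷ {x = x} (h ∷ L) (refl , lt , u , ar) x∉ a =
  refl , lt , All.tabulate (λ i eq → x∉ (subst (_∈ h ∷ L) (sym eq) i)) ∷ u ,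
  λ { _ _ (inj₁ (refl , refl)) → a ; y z (inj₂ ar') → ar y z ar' }

walk-head : ∀ {n} q (qs : Vec (List ℕ) n) qs' → ∃ λ X → walk (q ∷ᵛ qs) qs' ≡ q ++ X
walk-head q []ᵛ []ᵛ = [] , sym (++-identityʳ q)
walk-head q (q₂ ∷ᵛ qs) (q' ∷ᵛ qs') = _ , refl

walk-++ : ∀ {n} pre q (qs : Vec (List ℕ) n) qs'
        → walk ((pre ++ q) ∷ᵛ qs) qs' ≡ pre ++ walk (q ∷ᵛ qs) qs'
walk-++ pre q []ᵛ []ᵛ = refl
walk-++ pre q (q₂ ∷ᵛ qs) (q' ∷ᵛ qs') = ++-assoc pre q _

-- Each non-trivial gadget supplies a path of length at least b.
typeI-long : ∀ {b L} → 1 ≤ b → g b ≤ L + 1 → b ≤ L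
typeI-long {b} {L} 1≤b h = +-cancelʳ-≤ 1 b L (≤-trans b+1≤2b (≤-trans 2b≤4bb h))
  where
  b+1≤2b : b + 1 ≤ 2 * b
  b+1≤2b = +-monoʳ-≤ b (subst (1 ≤_) (sym (+-identityʳ b)) 1≤b)
  2b≤4bb : 2 * b ≤ 4 * b * b
  2b≤4bb = subst (_≤ 4 * b * b) (*-identityʳ (2 * b))
             (*-mono-≤ (*-mono-≤ {2} {4} (s≤s (s≤s z≤n)) (≤-refl {b})) 1≤b)

typeII-long : ∀ {b L} → 1 ≤ b → 2 * b * b + b ∸ 2 ≤ L → b ≤ L
typeII-long {b} 1≤b h = ≤-trans (∸-monoˡ-≤ 2 (+-monoˡ-≤ b 2≤2bb)) h
  where
  2≤2bb : 2 ≤ 2 * b * b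
  2≤2bb = *-mono-≤ (*-mono-≤ {2} {2} ≤-refl 1≤b) 1≤b

typeIII-long : ∀ {b L} → 1 ≤ b → 2 * b ∸ 1 ≤ L → b ≤ L
typeIII-long {suc b} _ h =
  ≤-trans (≤-trans (s≤s (m≤m+n b (b + 0))) (≤-reflexive (sym (+-suc b (b + 0))))) h

-- The gadget count needed for one forward path, and the count needed for
-- n+2 forward paths split as b spine arcs, one gadget, and the count for n+1.
count-one : ∀ b → 1 * (b + 1) ∸ 1 ≡ b
count-one b rewrite +-comm b 1 | +-identityʳ b = refl

count-step : ∀ n b → suc (suc n) * (b + 1) ∸ 1 ≡ b + suc (suc n * (b + 1) ∸ 1)
count-step n b rewrite +-comm b 1 = refl

isGadget : Maybe Gadget → ℕ
isGadget (just _) = 1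
isGadget nothing = 0

isGadget≤1 : ∀ x → isGadget x ≤ 1
isGadget≤1 (just _) = s≤s z≤n
isGadget≤1 nothing = z≤n

module Chain-Structure (b : ℕ) (C : Chain) (VC : ValidChain b C) where

  private variable
    i j k l : ℕ
    G H : Gadget

  M : ℕ
  M = m C

  D : ArcRel
  D = ChainArc C

  v-injective : ∀ {x y} → v C x ≡ v C y → x ≡ y
  v-injective = proj₁ VC

  gadgets-valid : ∀ i G → lab C i ≡ just G → ValidGadget b (vl C i) (vr C i) G
  gadgets-valid = proj₁ (proj₂ VC)

  gadget∩spine : ∀ i G → lab C i ≡ just G → ∀ x → GVert (vl C i) (vr C i) G x → OnSpine C x
               → x ≡ vl C i ⊎ x ≡ vr C i
  gadget∩spine i G e x gv on = proj₁ (proj₁ (proj₂ (proj₂ VC)) i G e x) (gv , on)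

  gadget∩gadget : ∀ i i' G H → i ≢ i' → lab C i ≡ just G → lab C i' ≡ just H → ∀ x
                → GVert (vl C i) (vr C i) G x → GVert (vl C i') (vr C i') H x → OnSpine C x
  gadget∩gadget = proj₂ (proj₂ (proj₂ VC))

  -- The spine vertex v_i and the gadget label of the arc (v_i, v_{i+1}),
  -- indexed by natural numbers (with junk values out of range).
  spine : ℕ → ℕ
  spine i with i <? suc M
  ... | yes i≤M = v C (fromℕ< i≤M)
  ... | no _ = 0

  label : ℕ → Maybe Gadget
  label i with i <? M
  ... | yes i<M = lab C (fromℕ< i<M)
  ... | no _ = nothing

  spine-at : (i≤M : i ≤ M) → spine i ≡ v C (fromℕ< (s≤s i≤M))
  spine-at {i} i≤M with i <? suc M
  ... | yes _ = refl
  ... | no i≮1+M = ⊥-elim (i≮1+M (s≤s i≤M))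

  spine-fin : (i : Fin (suc M)) → spine (toℕ i) ≡ v C i
  spine-fin i = trans (spine-at (≤-pred (toℕ<n i))) (cong (v C) (fromℕ<-toℕ i _))

  label-at : (i<M : i < M) → label i ≡ lab C (fromℕ< i<M)
  label-at {i} i<M with i <? M
  ... | yes _ = refl
  ... | no i≮M = ⊥-elim (i≮M i<M)

  label-in-range : label i ≡ just G → i < M
  label-in-range {i} e with i <? M
  ... | yes i<M = i<M
  label-in-range {i} () | no _

  spine-injective : i ≤ M → j ≤ M → spine i ≡ spine j → i ≡ j
  spine-injective {i} {j} i≤M j≤M e = fromℕ<-injective i j (s≤s i≤M) (s≤s j≤M)
    (v-injective (trans (sym (spine-at i≤M)) (trans e (spine-at j≤M))))

  spine-left : (i<M : i < M) → vl C (fromℕ< i<M) ≡ spine i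
  spine-left i<M = trans (sym (spine-fin (inject₁ (fromℕ< i<M))))
                         (cong spine (trans (toℕ-inject₁ (fromℕ< i<M)) (toℕ-fromℕ< i<M)))

  spine-right : (i<M : i < M) → vr C (fromℕ< i<M) ≡ spine (suc i)
  spine-right i<M = trans (sym (spine-fin (fsuc (fromℕ< i<M))))
                          (cong (λ z → spine (suc z)) (toℕ-fromℕ< i<M))

  spine-ends : ∀ {P : ℕ → ℕ → Set} (i<M : i < M)
             → P (spine i) (spine (suc i)) → P (vl C (fromℕ< i<M)) (vr C (fromℕ< i<M))
  spine-ends {P = P} i<M = subst₂ P (sym (spine-left i<M)) (sym (spine-right i<M))

  spine-ends⁻ : ∀ {P : ℕ → ℕ → Set} (i<M : i < M)
              → P (vl C (fromℕ< i<M)) (vr C (fromℕ< i<M)) → P (spine i) (spine (suc i))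
  spine-ends⁻ {P = P} i<M = subst₂ P (spine-left i<M) (spine-right i<M)

  lab-just : (e : label j ≡ just G) → lab C (fromℕ< (label-in-range e)) ≡ just G
  lab-just e = trans (sym (label-at (label-in-range e))) e

  GV : ℕ → Gadget → ℕ → Set
  GV j G x = GVert (spine j) (spine (suc j)) G x

  gadget-valid : label j ≡ just G → ValidGadget b (spine j) (spine (suc j)) G
  gadget-valid {G = G} e = spine-ends⁻ {P = λ x y → ValidGadget b x y G} (label-in-range e)
    (gadgets-valid _ G (lab-just e))

  gadget-arc : ∀ {x y} → label j ≡ just G → GArc (spine j) (spine (suc j)) G x y → D x y
  gadget-arc {G = G} {x} {y} e ga =
    inj₂ (_ , G , lab-just e , spine-ends {P = λ p q → GArc p q G x y} (label-in-range e) ga)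

  spine-arc : i < M → D (spine i) (spine (suc i))
  spine-arc {i} i<M = inj₁ (_ , spine-ends {P = λ p q → spine i ≡ p × spine (suc i) ≡ q} i<M (refl , refl))

  gadget-meets-spine : ∀ {x} → label j ≡ just G → GV j G x → i ≤ M → spine i ≡ x
                     → x ≡ spine j ⊎ x ≡ spine (suc j)
  gadget-meets-spine {G = G} {x = x} e gv i≤M ex =
    spine-ends⁻ {P = λ p q → x ≡ p ⊎ x ≡ q} (label-in-range e)
      (gadget∩spine _ G (lab-just e) x (spine-ends {P = λ p q → GVert p q G x} (label-in-range e) gv)
        (fromℕ< (s≤s i≤M) , trans (sym (spine-at i≤M)) ex))

  gadgets-meet-on-spine : ∀ {x} → label j ≡ just G → label l ≡ just H → j ≢ l → GV j G x → GV l H x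
                        → ∃ λ i → i ≤ M × spine i ≡ x
  gadgets-meet-on-spine {j} {G} {l} {H} {x} ej el j≢l gj gl
    with gadget∩gadget _ _ G H fin≢ (lab-just ej) (lab-just el) x
           (spine-ends {P = λ p q → GVert p q G x} (label-in-range ej) gj)
           (spine-ends {P = λ p q → GVert p q H x} (label-in-range el) gl)
    where
    fin≢ : fromℕ< (label-in-range ej) ≢ fromℕ< (label-in-range el)
    fin≢ eq = j≢l (trans (sym (toℕ-fromℕ< (label-in-range ej)))
                         (trans (cong toℕ eq) (toℕ-fromℕ< (label-in-range el))))
  ... | i , ei = toℕ i , ≤-pred (toℕ<n i) , trans (spine-fin i) ei

  FromSpine : ℕ → ℕ → Set
  FromSpine k x = Σ ℕ λ i → k ≤ i × i ≤ M × spine i ≡ x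

  From : ℕ → ℕ → Set
  From k x = FromSpine k x ⊎ (Σ ℕ λ l → Σ Gadget λ G → k ≤ l × label l ≡ just G × GV l G x)

  From-mono : ∀ {x} → k ≤ l → From l x → From k x
  From-mono k≤l (inj₁ (i , l≤i , i≤M , e)) = inj₁ (i , ≤-trans k≤l l≤i , i≤M , e)
  From-mono k≤l (inj₂ (j , G , l≤j , e , gv)) = inj₂ (j , G , ≤-trans k≤l l≤j , e , gv)

  Upto : ℕ → ℕ → Gadget → ℕ → Set
  Upto k j G x = GV j G x ⊎ (Σ ℕ λ i → k ≤ i × i ≤ j × spine i ≡ x)

  Upto⇒From : ∀ {x} → k ≤ j → label j ≡ just G → Upto k j G x → From k x
  Upto⇒From k≤j e (inj₁ gv) = inj₂ (_ , _ , k≤j , e , gv)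
  Upto⇒From k≤j e (inj₂ (i , k≤i , i≤j , ex)) =
    inj₁ (i , k≤i , ≤-trans i≤j (<⇒≤ (label-in-range e)) , ex)

  From-on-spine : ∀ {x} → From k x → i ≤ M → spine i ≡ x → FromSpine k x
  From-on-spine (inj₁ s) _ _ = s
  From-on-spine (inj₂ (l , H , k≤l , el , gl)) i≤M ex with gadget-meets-spine el gl i≤M ex
  ... | inj₁ x≡vₗ = l , k≤l , <⇒≤ (label-in-range el) , sym x≡vₗ
  ... | inj₂ x≡vₗ₊₁ = suc l , m≤n⇒m≤1+n k≤l , label-in-range el , sym x≡vₗ₊₁

  gadget-meets-earlier-spine : ∀ {x} → label j ≡ just G → GV j G x → i ≤ j → spine i ≡ x
                             → x ≡ spine j
  gadget-meets-earlier-spine {j} e gv i≤j ex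
    with gadget-meets-spine e gv (≤-trans i≤j (<⇒≤ (label-in-range e))) ex
  ... | inj₁ x≡vⱼ = x≡vⱼ
  ... | inj₂ x≡vⱼ₊₁ = ⊥-elim (<⇒≢ (s≤s i≤j)
        (spine-injective (≤-trans i≤j (<⇒≤ (label-in-range e))) (label-in-range e) (trans ex x≡vⱼ₊₁)))

  gadget-meets-later-spine : ∀ {x} → label j ≡ just G → GV j G x → FromSpine (suc j) x
                           → x ≡ spine (suc j)
  gadget-meets-later-spine {j} e gv (i , j<i , i≤M , ex) with gadget-meets-spine e gv i≤M ex
  ... | inj₂ x≡vⱼ₊₁ = x≡vⱼ₊₁
  ... | inj₁ x≡vⱼ =
    ⊥-elim (<⇒≢ j<i (sym (spine-injective i≤M (<⇒≤ (label-in-range e)) (trans ex x≡vⱼ))))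

  earlier-spine-not-later : i ≤ j → j < M → From (suc j) (spine i) → ⊥
  earlier-spine-not-later i≤j j<M f with From-on-spine f (≤-trans i≤j (<⇒≤ j<M)) refl
  ... | i' , j<i' , i'≤M , ex =
    <⇒≢ (≤-<-trans i≤j j<i') (spine-injective (≤-trans i≤j (<⇒≤ j<M)) i'≤M (sym ex))

  separation : ∀ {x} → label j ≡ just G → Upto k j G x → From (suc j) x → x ≡ spine (suc j)
  separation e (inj₁ gv) (inj₁ s) = gadget-meets-later-spine e gv s
  separation e (inj₁ gv) f@(inj₂ (l , H , j<l , el , gl))
    with gadgets-meet-on-spine e el (<⇒≢ j<l) gv gl
  ... | i , i≤M , ex = gadget-meets-later-spine e gv (From-on-spine f i≤M ex)
  separation e (inj₂ (i , _ , i≤j , refl)) f = ⊥-elim (earlier-spine-not-later i≤j (label-in-range e) f)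

  segment : ℕ → ℕ → List ℕ
  segment k zero = [ spine k ]
  segment k (suc d) = spine k ∷ segment (suc k) d

  segment-head : ∀ k d → head (segment k d) ≡ just (spine k)
  segment-head k zero = refl
  segment-head k (suc d) = refl

  segment-last : ∀ k d → last (segment k d) ≡ just (spine (k + d))
  segment-last k zero = cong (λ z → just (spine z)) (sym (+-identityʳ k))
  segment-last k (suc zero) = cong (λ z → just (spine z)) (sym (+-comm k 1))
  segment-last k (suc (suc d)) =
    trans (segment-last (suc k) (suc d)) (cong (λ z → just (spine z)) (sym (+-suc k (suc d))))

  segment-len : ∀ k d → len (segment k d) ≡ d
  segment-len k zero = refl
  segment-len k (suc zero) = refl
  segment-len k (suc (suc d)) = cong suc (segment-len (suc k) (suc d))

  segment-∈ : ∀ {x} k d → x ∈ segment k d → Σ ℕ λ i → k ≤ i × i ≤ k + d × spine i ≡ x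
  segment-∈ k zero (here refl) = k , ≤-refl , m≤m+n k 0 , refl
  segment-∈ k (suc d) (here refl) = k , ≤-refl , m≤m+n k (suc d) , refl
  segment-∈ k (suc d) (there i) with segment-∈ (suc k) d i
  ... | l , k<l , l≤ , e = l , <⇒≤ k<l , subst (l ≤_) (sym (+-suc k d)) l≤ , e

  segment-unique : ∀ k d → k + d ≤ M → Unique (segment k d)
  segment-unique k zero _ = All.[] ∷ []
  segment-unique k (suc d) k+d≤M =
    All.tabulate vₖ∉ ∷ segment-unique (suc k) d (subst (_≤ M) (+-suc k d) k+d≤M)
    where
    vₖ∉ : ∀ {x} → x ∈ segment (suc k) d → spine k ≢ x
    vₖ∉ i eq with segment-∈ (suc k) d i
    ... | l , k<l , l≤ , e = <⇒≢ k<l (spine-injective (≤-trans (m≤m+n k (suc d)) k+d≤M)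
                                     (≤-trans l≤ (subst (_≤ M) (+-suc k d) k+d≤M)) (trans eq (sym e)))

  segment-arc : ∀ {x y} k d → ArcOf (segment k d) x y
              → Σ ℕ λ i → i < k + d × x ≡ spine i × y ≡ spine (suc i)
  segment-arc k (suc zero) (inj₁ (ex , ey)) =
    k , subst (k <_) (sym (+-suc k 0)) (s≤s (m≤m+n k 0)) , ex , ey
  segment-arc k (suc (suc d)) (inj₁ (ex , ey)) =
    k , subst (k <_) (sym (+-suc k (suc d))) (s≤s (m≤m+n k (suc d))) , ex , ey
  segment-arc k (suc (suc d)) (inj₂ ar) with segment-arc (suc k) (suc d) ar
  ... | i , i< , e = i , subst (i <_) (sym (+-suc k (suc d))) i< , e

  segment-path : ∀ k d → k + d ≤ M → DirPath D (spine k) (spine (k + d)) (segment k d)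
  segment-path k d k+d≤M = segment-head k d , segment-last k d , segment-unique k d k+d≤M , arcs
    where
    arcs : ∀ x y → ArcOf (segment k d) x y → D x y
    arcs x y ar with segment-arc k d ar
    ... | i , i< , refl , refl = spine-arc (<-≤-trans i< k+d≤M)

  gadgetsIn : ℕ → ℕ → ℕ
  gadgetsIn zero i = 0
  gadgetsIn (suc d) i = isGadget (label i) + gadgetsIn d (suc i)

  gadgetsFrom : ℕ → ℕ
  gadgetsFrom k = gadgetsIn (M ∸ k) k

  A₂size≡gadgetsFrom0 : A₂size C ≡ gadgetsFrom 0
  A₂size≡gadgetsFrom0 =
    count M 0 (lab C) λ x → sym (trans (label-at (toℕ<n x)) (cong (lab C) (fromℕ<-toℕ x (toℕ<n x))))
    where
    count : ∀ d i (f : Fin d → Maybe Gadget) → (∀ x → f x ≡ label (i + toℕ x))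
          → countJust f ≡ gadgetsIn d i
    count zero i f hf = refl
    count (suc d) i f hf with f fzero | hf fzero
    ... | just G | e rewrite +-identityʳ i | sym e =
      cong suc (count d (suc i) (λ x → f (fsuc x)) λ x → trans (hf (fsuc x)) (cong label (+-suc i (toℕ x))))
    ... | nothing | e rewrite +-identityʳ i | sym e =
      count d (suc i) (λ x → f (fsuc x)) λ x → trans (hf (fsuc x)) (cong label (+-suc i (toℕ x)))

  gadgetsFrom-step : k < M → gadgetsFrom k ≡ isGadget (label k) + gadgetsFrom (suc k)
  gadgetsFrom-step {k} k<M rewrite +-∸-assoc 1 k<M = refl

  gadgetsFrom-end : M ≤ k → gadgetsFrom k ≡ 0
  gadgetsFrom-end M≤k rewrite m≤n⇒m∸n≡0 M≤k = refl

  gadgetsFrom-suc : ∀ k → gadgetsFrom k ≤ 1 + gadgetsFrom (suc k)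
  gadgetsFrom-suc k with k <? M
  ... | yes k<M rewrite gadgetsFrom-step k<M =
    +-monoˡ-≤ (gadgetsFrom (suc k)) (isGadget≤1 (label k))
  ... | no k≮M rewrite gadgetsFrom-end (≮⇒≥ k≮M) = z≤n

  gadgetsFrom-shift : ∀ k d → gadgetsFrom k ≤ d + gadgetsFrom (k + d)
  gadgetsFrom-shift k zero rewrite +-identityʳ k = ≤-refl
  gadgetsFrom-shift k (suc d) rewrite +-suc k d = ≤-trans (gadgetsFrom-shift k d)
    (subst (d + gadgetsFrom (k + d) ≤_) (+-suc d _) (+-monoʳ-≤ d (gadgetsFrom-suc (k + d))))

  gadgetsFrom-bound : ∀ k → k ≤ M → gadgetsFrom k ≤ M ∸ k
  gadgetsFrom-bound k k≤M = subst (gadgetsFrom k ≤_) (+-identityʳ (M ∸ k))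
    (subst (λ z → gadgetsFrom k ≤ (M ∸ k) + z)
      (gadgetsFrom-end (≤-reflexive (sym (m+[n∸m]≡n k≤M)))) (gadgetsFrom-shift k (M ∸ k)))

  next-gadget : ∀ c i → suc c ≤ gadgetsFrom i
              → Σ ℕ λ j → Σ Gadget λ G → i ≤ j × label j ≡ just G × c ≤ gadgetsFrom (suc j)
  next-gadget c i = search M i (m≤n+m M i)
    where
    search : ∀ fuel i → M ≤ i + fuel → suc c ≤ gadgetsFrom i
           → Σ ℕ λ j → Σ Gadget λ G → i ≤ j × label j ≡ just G × c ≤ gadgetsFrom (suc j)
    search zero i M≤i h with () ← subst (suc c ≤_) (gadgetsFrom-end (subst (M ≤_) (+-identityʳ i) M≤i)) h
    search (suc fuel) i M≤i h with i <? M
    ... | no i≮M with () ← subst (suc c ≤_) (gadgetsFrom-end (≮⇒≥ i≮M)) h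
    ... | yes i<M with label i in e | subst (suc c ≤_) (gadgetsFrom-step i<M) h
    ...   | just G  | h' = i , G , ≤-refl , e , ≤-pred h'
    ...   | nothing | h' with search fuel (suc i) (subst (M ≤_) (+-suc i fuel) M≤i) h'
    ...     | j , G , i<j , ej , hj = j , G , <⇒≤ i<j , ej , hj

  -- The first forward path Q₀ is kept apart from the
  -- others, so that it can be extended.
  record TailPath (n k : ℕ) : Set where
    field
      srcs tgts : Fin (suc n) → ℕ
      Q₀ : List ℕ
      Qrest : Vec (List ℕ) n
      Qback : Vec (List ℕ) n
      fwd-path : ∀ i → DirPath D (srcs i) (tgts i) (lookup (Q₀ ∷ᵛ Qrest) i)
      back-path : ∀ i → DirPath D (srcs (fsuc i)) (tgts (inject₁ i)) (lookup Qback i)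
      distinct : Unique (walk (Q₀ ∷ᵛ Qrest) Qback)
      fwd-long : ∀ i → b ≤ len (lookup (Q₀ ∷ᵛ Qrest) i)
      back-long : ∀ i → b ≤ len (lookup Qback i)
      starts : srcs fzero ≡ spine k
      ends : tgts (fromℕ n) ≡ spine M
      inside : ∀ {x} → x ∈ walk (Q₀ ∷ᵛ Qrest) Qback → From k x

  open TailPath

  tail-walk : ∀ {n k} → TailPath n k → List ℕ
  tail-walk T = walk (Q₀ T ∷ᵛ Qrest T) (Qback T)

  segment-tail : ∀ k → k ≤ M → b ≤ M ∸ k → TailPath 0 k
  segment-tail k k≤M b≤ = record
    { srcs = λ _ → spine k ; tgts = λ _ → spine M
    ; Q₀ = segment k (M ∸ k) ; Qrest = []ᵛ ; Qback = []ᵛ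
    ; fwd-path = λ { fzero → subst (λ z → DirPath D (spine k) (spine z) (segment k (M ∸ k))) k+d≡M
                                   (segment-path k (M ∸ k) (≤-reflexive k+d≡M)) }
    ; back-path = λ ()
    ; distinct = segment-unique k (M ∸ k) (≤-reflexive k+d≡M)
    ; fwd-long = λ { fzero → subst (b ≤_) (sym (segment-len k (M ∸ k))) b≤ }
    ; back-long = λ ()
    ; starts = refl ; ends = refl
    ; inside = λ i → inj₁ (in-range (segment-∈ k (M ∸ k) i))
    }
    where
    k+d≡M : k + (M ∸ k) ≡ M
    k+d≡M = m+[n∸m]≡n k≤M
    in-range : ∀ {x} → (Σ ℕ λ i → k ≤ i × i ≤ k + (M ∸ k) × spine i ≡ x) → FromSpine k x
    in-range (i , k≤i , i≤ , e) = i , k≤i , subst (i ≤_) k+d≡M i≤ , e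

  -- Extension: prepend to a tail path T a new first forward path Q₁ from v_k
  -- and a backward path Q'₁ into its end t₁, where the old first forward path
  -- is extended at its start by pre so as to begin at the start s₂ of Q'₁.
  extend : ∀ {n k' k} (T : TailPath n k') (Q₁ Q'₁ pre : List ℕ) {s₂ t₁ : ℕ}
         → DirPath D (spine k) t₁ Q₁ → DirPath D s₂ t₁ Q'₁
         → DirPath D s₂ (tgts T fzero) (pre ++ Q₀ T)
         → b ≤ len Q₁ → b ≤ len Q'₁
         → Unique (Q₁ ++ drop 1 (reverse Q'₁) ++ drop 1 (pre ++ tail-walk T))
         → (∀ {x} → x ∈ Q₁ ++ drop 1 (reverse Q'₁) ++ drop 1 (pre ++ tail-walk T) → From k x)
         → TailPath (suc n) k
  extend {k = k} T Q₁ Q'₁ pre {s₂} {t₁} Q₁-path Q'₁-path Q₂-path Q₁-long Q'₁-long uniq ins = record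
    { srcs = λ { fzero → spine k ; (fsuc fzero) → s₂ ; (fsuc (fsuc i)) → srcs T (fsuc i) }
    ; tgts = λ { fzero → t₁ ; (fsuc i) → tgts T i }
    ; Q₀ = Q₁ ; Qrest = (pre ++ Q₀ T) ∷ᵛ Qrest T ; Qback = Q'₁ ∷ᵛ Qback T
    ; fwd-path = λ { fzero → Q₁-path ; (fsuc fzero) → Q₂-path ; (fsuc (fsuc i)) → fwd-path T (fsuc i) }
    ; back-path = λ { fzero → Q'₁-path ; (fsuc i) → back-path T i }
    ; distinct = subst (λ w → Unique (Q₁ ++ drop 1 (reverse Q'₁) ++ drop 1 w)) (sym walk≡) uniq
    ; fwd-long = λ { fzero → Q₁-long
                   ; (fsuc fzero) → ≤-trans (fwd-long T fzero) (len-++ʳ pre (Q₀ T))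
                   ; (fsuc (fsuc i)) → fwd-long T (fsuc i) }
    ; back-long = λ { fzero → Q'₁-long ; (fsuc i) → back-long T i }
    ; starts = refl
    ; ends = ends T
    ; inside = λ i → ins (subst (λ w → _ ∈ Q₁ ++ drop 1 (reverse Q'₁) ++ drop 1 w) walk≡ i)
    }
    where
    walk≡ : walk ((pre ++ Q₀ T) ∷ᵛ Qrest T) (Qback T) ≡ pre ++ tail-walk T
    walk≡ = walk-++ pre (Q₀ T) (Qrest T) (Qback T)

  module Step {n k j : ℕ} {G : Gadget}
    (T : TailPath n (suc j)) (k+b≤j : k + b ≤ j) (e : label j ≡ just G) where

    p q : ℕ
    p = spine j
    q = spine (suc j)

    j<M : j < M
    j<M = label-in-range e

    k≤j : k ≤ j
    k≤j = ≤-trans (m≤m+n k b) k+b≤j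

    k+d≡j : k + (j ∸ k) ≡ j
    k+d≡j = m+[n∸m]≡n k≤j

    S : List ℕ
    S = segment k (j ∸ k)

    S-path : DirPath D (spine k) p S
    S-path = subst (λ z → DirPath D (spine k) (spine z) S) k+d≡j
               (segment-path k (j ∸ k) (≤-trans (≤-reflexive k+d≡j) (<⇒≤ j<M)))

    S-unique : Unique S
    S-unique = proj₁ (proj₂ (proj₂ S-path))

    S-long : b ≤ len S
    S-long = subst (b ≤_) (sym (segment-len k (j ∸ k)))
               (subst (_≤ j ∸ k) (m+n∸m≡n k b) (∸-monoˡ-≤ k k+b≤j))

    S-spine : ∀ {y} → y ∈ S → Σ ℕ λ i → k ≤ i × i ≤ j × spine i ≡ y
    S-spine i with segment-∈ k (j ∸ k) i
    ... | l , k≤l , l≤ , ey = l , k≤l , subst (l ≤_) k+d≡j l≤ , ey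

    S-upto : ∀ {y} → y ∈ S → Upto k j G y
    S-upto i = inj₂ (S-spine i)

    S-meets-gadget : ∀ {y} → y ∈ S → GV j G y → y ≡ p
    S-meets-gadget i gv with S-spine i
    ... | l , _ , l≤j , ey = gadget-meets-earlier-spine e gv l≤j ey

    S-avoids-q : ∀ {y} → y ∈ S → y ≢ q
    S-avoids-q i y≡q with S-spine i
    ... | l , _ , l≤j , ey =
      <⇒≢ (s≤s l≤j) (spine-injective (≤-trans l≤j (<⇒≤ j<M)) j<M (trans ey y≡q))

    W : List ℕ
    W = tail-walk T

    W-from : ∀ {y} → y ∈ W → From (suc j) y
    W-from = inside T

    Q₀-path : DirPath D q (tgts T fzero) (Q₀ T)
    Q₀-path = subst (λ z → DirPath D z (tgts T fzero) (Q₀ T)) (starts T) (fwd-path T fzero)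

    Q₀⊆W : ∀ {y} → y ∈ Q₀ T → y ∈ W
    Q₀⊆W {y} i with walk-head (Q₀ T) (Qrest T) (Qback T)
    ... | X , eq = subst (y ∈_) (sym eq) (∈-++⁺ˡ i)

    later-avoids-q : ∀ {y} → y ∈ drop 1 W → y ≢ q
    later-avoids-q i refl with walk-head (Q₀ T) (Qrest T) (Qback T)
    ... | X , eq = head∉drop1 W (distinct T) (trans (cong head eq) (head-++ (Q₀ T) X (proj₁ Q₀-path))) i

    -- New pieces A ++ B taken from the part up to the gadget combine with a
    -- part T' of W to a duplicate-free sequence inside the part from v_k, as
    -- long as q, the only vertex the two parts can share, is avoided.
    finish : ∀ A B {T'} → Unique (A ++ B) → Unique T' → (∀ {y} → y ∈ T' → y ∈ W)
           → (∀ {y} → y ∈ A ++ B → y ∈ T' → y ≢ q) → (∀ {y} → y ∈ A ++ B → Upto k j G y)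
           → Unique (A ++ B ++ T') × (∀ {x} → x ∈ A ++ B ++ T' → From k x)
    finish A B {T'} uAB uT' T'⊆W avoid upto =
      subst Unique (++-assoc A B T')
        (++⁺ uAB uT' (λ (i , i') → avoid i i' (separation e (upto i) (W-from (T'⊆W i'))))) ,
      λ i → ∈-++-elim (Upto⇒From k≤j e ∘ upto) (From-mono (m≤n⇒m≤1+n k≤j) ∘ W-from ∘ T'⊆W)
              (subst (_ ∈_) (sym (++-assoc A B T')) i)

  -- Type I: Q₁ = S, and Q'₁ is the cycle minus the arc (p, q), from q to p.
  through-typeI : ∀ {n k j c} → 1 ≤ b → TailPath n (suc j) → k + b ≤ j → label j ≡ just (typeI c)
                → TailPath (suc n) k
  through-typeI {k = k} {j} {c} 1≤b T k+b≤j e with gadget-valid e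
  ... | _ , (c-head , c-last , c-unique) , c-long =
    extend T S c [] S-path c-path Q₀-path S-long (typeI-long 1≤b c-long)
      (proj₁ assembled) (proj₂ assembled)
    where
    open Step T k+b≤j e
    c-path : DirPath D q p c
    c-path = c-head , c-last , c-unique , λ x y ar → gadget-arc e (inj₂ ar)
    B : List ℕ
    B = drop 1 (reverse c)
    B-unique : Unique B
    B-unique = proj₁ (reverse-init c c-unique c-last)
    B-vertex : ∀ {y} → y ∈ B → y ∈ c × y ≢ p
    B-vertex = proj₂ (reverse-init c c-unique c-last)
    B-gadget : ∀ {y} → y ∈ B → GV j (typeI c) y
    B-gadget i = inj₂ (inj₂ (proj₁ (B-vertex i)))
    S∩B : ∀ {y} → y ∈ S → y ∈ B → ⊥
    S∩B i i' = proj₂ (B-vertex i') (S-meets-gadget i (B-gadget i'))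
    assembled : Unique (S ++ B ++ drop 1 W) × (∀ {x} → x ∈ S ++ B ++ drop 1 W → From k x)
    assembled = finish S B (++⁺ S-unique B-unique (λ (i , i') → S∩B i i')) (drop⁺ 1 (distinct T))
                  (∈-drop1 W) (λ _ → later-avoids-q) (∈-++-elim S-upto (inj₁ ∘ B-gadget))

  -- Type II: Q₁ = S, Q'₁ = the final b arcs x … p of P₁, and the old first
  -- forward path is extended at its start by the arc (x, q).
  through-typeII : ∀ {n k j r P₁} → 1 ≤ b → TailPath n (suc j) → k + b ≤ j
                 → label j ≡ just (typeII r P₁) → TailPath (suc n) k
  through-typeII {k = k} {j} {r} {P₁} 1≤b T k+b≤j e with gadget-valid e
  ... | (_ , P₁-last , P₁-unique) , q∉P₁ , P₁-long
    with split-suffix P₁ b (≤len⇒<length P₁ 1≤b (typeII-long 1≤b P₁-long))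
  ... | ys , x , zs , refl , |zs|≡b =
    extend T S Q'₁ [ x ] S-path Q'₁-path Q₂-path S-long (≤-reflexive (sym |zs|≡b))
      (proj₁ assembled) (proj₂ assembled)
    where
    open Step T k+b≤j e
    Q'₁ : List ℕ
    Q'₁ = x ∷ zs
    Q'₁⊆P₁ : ∀ {y} → y ∈ Q'₁ → y ∈ ys ++ Q'₁
    Q'₁⊆P₁ = ∈-++⁺ʳ ys
    P₁-gadget : ∀ {y} → y ∈ ys ++ Q'₁ → GV j (typeII r (ys ++ Q'₁)) y
    P₁-gadget i = inj₂ (inj₂ (inj₂ i))
    Q'₁-unique : Unique Q'₁
    Q'₁-unique = unique-++ʳ ys P₁-unique
    Q'₁-last : last Q'₁ ≡ just p
    Q'₁-last = trans (sym (last-++-∷ ys x zs)) P₁-last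
    Q'₁-path : DirPath D x p Q'₁
    Q'₁-path = refl , Q'₁-last , Q'₁-unique , λ a c ar → gadget-arc e (inj₁ (arc-suffix ys Q'₁ ar))
    -- x ≠ q lies in the gadget, so by separation it does not occur in T.
    x∈P₁ : x ∈ ys ++ Q'₁
    x∈P₁ = Q'₁⊆P₁ (here refl)
    x∉Q₀ : x ∉ Q₀ T
    x∉Q₀ i = q∉P₁ (subst (_∈ ys ++ Q'₁) x≡q x∈P₁)
      where
      x≡q : x ≡ q
      x≡q = separation {k = k} e (inj₁ (P₁-gadget x∈P₁)) (W-from (Q₀⊆W i))
    Q₂-path : DirPath D x (tgts T fzero) (x ∷ Q₀ T)
    Q₂-path = path-∷ (Q₀ T) Q₀-path x∉Q₀ (gadget-arc e (inj₂ (x∈P₁ , refl)))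
    B : List ℕ
    B = drop 1 (reverse Q'₁)
    B-unique : Unique B
    B-unique = proj₁ (reverse-init Q'₁ Q'₁-unique Q'₁-last)
    B⊆P₁ : ∀ {y} → y ∈ B → y ∈ ys ++ Q'₁
    B⊆P₁ = Q'₁⊆P₁ ∘ proj₁ ∘ proj₂ (reverse-init Q'₁ Q'₁-unique Q'₁-last)
    B≢p : ∀ {y} → y ∈ B → y ≢ p
    B≢p = proj₂ ∘ proj₂ (reverse-init Q'₁ Q'₁-unique Q'₁-last)
    S∩B : ∀ {y} → y ∈ S → y ∈ B → ⊥
    S∩B i i' = B≢p i' (S-meets-gadget i (P₁-gadget (B⊆P₁ i')))
    B-avoids-q : ∀ {y} → y ∈ B → y ≢ q
    B-avoids-q i refl = q∉P₁ (B⊆P₁ i)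
    assembled : Unique (S ++ B ++ W) × (∀ {x} → x ∈ S ++ B ++ W → From k x)
    assembled = finish S B (++⁺ S-unique B-unique (λ (i , i') → S∩B i i')) (distinct T) (λ i → i)
                  (λ i _ → ∈-++-elim S-avoids-q B-avoids-q i)
                  (∈-++-elim S-upto (inj₁ ∘ P₁-gadget ∘ B⊆P₁))

  -- Type III: Q₁ = S followed by P₁ (from v_k via p to r), and Q'₁ = P₂ (from q to r).
  through-typeIII : ∀ {n k j r P₁ P₂} → 1 ≤ b → TailPath n (suc j) → k + b ≤ j
                  → label j ≡ just (typeIII r P₁ P₂) → TailPath (suc n) k
  through-typeIII {k = k} {j} {r} {P₁} {P₂} 1≤b T k+b≤j e with gadget-valid e
  ... | _ , (P₁-head , P₁-last , P₁-unique) , (P₂-head , P₂-last , P₂-unique) , P₁∩P₂ , _ , P₂-long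
    with head-split P₁ P₁-head
  ... | P₁t , refl =
    extend T Q₁ P₂ [] Q₁-path P₂-path Q₀-path
      (≤-trans S-long (len-++ˡ S P₁t)) (typeIII-long 1≤b P₂-long)
      (proj₁ assembled) (proj₂ assembled)
    where
    open Step T k+b≤j e
    P₁-gadget : ∀ {y} → y ∈ P₁ → GV j (typeIII r P₁ P₂) y
    P₁-gadget i = inj₂ (inj₂ (inj₂ (inj₁ i)))
    P₂-gadget : ∀ {y} → y ∈ P₂ → GV j (typeIII r P₁ P₂) y
    P₂-gadget i = inj₂ (inj₂ (inj₂ (inj₂ i)))
    P₁-path : DirPath D p r P₁
    P₁-path = P₁-head , P₁-last , P₁-unique , λ x y ar → gadget-arc e (inj₂ (inj₁ ar))
    P₂-path : DirPath D q r P₂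
    P₂-path = P₂-head , P₂-last , P₂-unique , λ x y ar → gadget-arc e (inj₂ (inj₂ ar))
    Q₁ : List ℕ
    Q₁ = S ++ P₁t
    Q₁-path : DirPath D (spine k) r Q₁
    Q₁-path = path-++ S P₁t S-path P₁-path λ i i' →
      Unique[x∷xs]⇒x∉xs P₁-unique (subst (_∈ P₁t) (S-meets-gadget i (P₁-gadget (there i'))) i')
    -- a vertex of Q₁ on P₂ lies on P₁, hence is r
    Q₁∩P₂ : ∀ {y} → y ∈ Q₁ → y ∈ P₂ → y ≡ r
    Q₁∩P₂ i i' = P₁∩P₂ _ (on-P₁ i i') i'
      where
      on-P₁ : ∀ {y} → y ∈ Q₁ → y ∈ P₂ → y ∈ P₁
      on-P₁ = ∈-++-elim (λ i i' → here (S-meets-gadget i (P₂-gadget i'))) (λ i _ → there i)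
    B : List ℕ
    B = drop 1 (reverse P₂)
    B-unique : Unique B
    B-unique = proj₁ (reverse-init P₂ P₂-unique P₂-last)
    B-vertex : ∀ {y} → y ∈ B → y ∈ P₂ × y ≢ r
    B-vertex = proj₂ (reverse-init P₂ P₂-unique P₂-last)
    Q₁∩B : ∀ {y} → y ∈ Q₁ → y ∈ B → ⊥
    Q₁∩B i i' = proj₂ (B-vertex i') (Q₁∩P₂ i (proj₁ (B-vertex i')))
    assembled : Unique (Q₁ ++ B ++ drop 1 W) × (∀ {x} → x ∈ Q₁ ++ B ++ drop 1 W → From k x)
    assembled = finish Q₁ B (++⁺ (proj₁ (proj₂ (proj₂ Q₁-path))) B-unique (λ (i , i') → Q₁∩B i i'))
                  (drop⁺ 1 (distinct T)) (∈-drop1 W) (λ _ → later-avoids-q)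
                  (∈-++-elim (∈-++-elim S-upto (inj₁ ∘ P₁-gadget ∘ there))
                             (inj₁ ∘ P₂-gadget ∘ proj₁ ∘ B-vertex))

  through-gadget : ∀ {n k j G} → 1 ≤ b → TailPath n (suc j) → k + b ≤ j → label j ≡ just G
                 → TailPath (suc n) k
  through-gadget {G = typeI c} = through-typeI
  through-gadget {G = typeII r P₁} = through-typeII
  through-gadget {G = typeIII r P₁ P₂} = through-typeIII

  tail-path : 1 ≤ b → ∀ n k → k ≤ M → suc n * (b + 1) ∸ 1 ≤ gadgetsFrom k → TailPath n k
  tail-path 1≤b zero k k≤M h =
    segment-tail k k≤M (≤-trans (subst (_≤ gadgetsFrom k) (count-one b) h) (gadgetsFrom-bound k k≤M))
  tail-path 1≤b (suc n) k k≤M h with next-gadget (suc n * (b + 1) ∸ 1) (k + b) enough-after-b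
    where
    enough-after-b : suc (suc n * (b + 1) ∸ 1) ≤ gadgetsFrom (k + b)
    enough-after-b = +-cancelˡ-≤ b _ _
      (≤-trans (subst (_≤ gadgetsFrom k) (count-step n b) h) (gadgetsFrom-shift k b))
  ... | j , G , k+b≤j , e , hj = through-gadget 1≤b (tail-path 1≤b n (suc j) (label-in-range e) hj) k+b≤j e

  alternating-path : ∀ {n} → TailPath n 0
    → Σ (AltPath D (suc n) b) λ R → Strong R × first-s R ≡ v C fzero × last-t R ≡ v C (fromℕ M)
  alternating-path {n} T = R , fwd-long T , trans (starts T) (spine-fin fzero) ,
    trans (ends T) (trans (cong spine (sym (toℕ-fromℕ M))) (spine-fin (fromℕ M)))
    where
    R : AltPath D (suc n) b
    R = record
      { n = n ; a≡ = refl ; s = srcs T ; t = tgts T ; Q = Q₀ T ∷ᵛ Qrest T ; Q' = Qback T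
      ; Q-path = fwd-path T ; Q'-path = back-path T ; oriented = distinct T
      ; Q'-long = back-long T ; Q-mid-long = λ i _ _ → fwd-long T i }

lemma2p7 : (a b : ℕ) → 1 ≤ a → 1 ≤ b → (C : Chain) → ValidChain b C
    → a * (b + 1) ∸ 1 ≤ A₂size C
    → Σ (AltPath (ChainArc C) a b) λ R →
        Strong R × first-s R ≡ v C fzero × last-t R ≡ v C (fromℕ (m C))
lemma2p7 (suc n) b _ 1≤b C VC h =
  alternating-path (tail-path 1≤b n 0 z≤n (subst (_ ≤_) A₂size≡gadgetsFrom0 h))
  where open Chain-Structure b C VC
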